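{- Let $\pi$ be a $\{123,312\}$-sortable permutation with left-to-right maxima decomposition $\pi=M_1B_1\cdots M_tB_t$, and write $\mathrm{out}^{123,312}(\pi)=\tilde B_1\cdots\tilde B_tM_t\cdots M_1$ where each $\tilde B_i$ is a rearrangement of $B_i$. Then: (1) each $B_i$ avoids $213$; (2) $\tilde B_i=\mathrm{out}^{12}(B_i)$ for each $i$.
   Context: A sequence contains a pattern $\tau$ if it has a subsequence order-isomorphic to $\tau$. For a set $T$ of patterns, a $T$-stack is a stack whose content, read top to bottom, must never contain an occurrence of a pattern of $T$; an input sequence of distinct integers is processed greedily: push the next input element if this creates no forbidden occurrence in the stack, otherwise pop the top element to the output; $\mathrm{out}^T(w)$ is the resulting output (so $\mathrm{out}^{12}(w)$ is the output of a $\{12\}$-stack on $w$). The $T$-machine is the $T$-stack followed by a $\{21\}$-stack (classical stack, greedy); $\pi$ is $T$-sortable if the output of the $T$-machine on $\pi$ is the increasing permutation. It is a fact that for any permutation the output of the $\{123,312\}$-stack has the form $\tilde B_1\cdots\tilde B_tM_t\cdots M_1$. The left-to-right maxima decomposition is $\pi=M_1B_1\cdots M_tB_t$ where $M_1<\cdots<M_t$ are the left-to-right maxima (entries larger than all previous entries) and $B_i$ is the factor between $M_i$ and $M_{i+1}$ ($B_t$ after $M_t$). -}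

module Defs where

open import Data.Bool using (Bool; true; false; _∧_; _∨_; not; if_then_else_)
open import Data.Nat using (ℕ; zero; suc; _<ᵇ_)
open import Data.List using (List; []; _∷_; _++_; map; concat; zipWith; upTo)
open import Data.Bool.ListAction using (any; all)
open import Data.Product using (_×_; _,_)
open import Relation.Binary.PropositionalEquality using (_≡_)

-- Sequences are lists of natural numbers; a stack is a list read top to bottom.

_==ᵇ_ : Bool → Bool → Bool
true  ==ᵇ b = b
false ==ᵇ b = not b

subseqs : List ℕ → List (List ℕ)
subseqs []      = [] ∷ []
subseqs (x ∷ w) = let r = subseqs w in map (x ∷_) r ++ r

orderIso : List ℕ → List ℕ → Bool
orderIso [] [] = true
orderIso (a ∷ u) (b ∷ v) = pairs u v ∧ orderIso u v
  where
  pairs : List ℕ → List ℕ → Bool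
  pairs (x ∷ u') (y ∷ v') =
    ((a <ᵇ x) ==ᵇ (b <ᵇ y)) ∧ ((x <ᵇ a) ==ᵇ (y <ᵇ b)) ∧ pairs u' v'
  pairs _ _ = true
orderIso _ _ = false

contains : List ℕ → List ℕ → Bool
contains w τ = any (λ u → orderIso u τ) (subseqs w)

avoids : List ℕ → List ℕ → Bool
avoids w τ = not (contains w τ)

avoidsAll : List (List ℕ) → List ℕ → Bool
avoidsAll T w = all (avoids w) T

pushStep : List (List ℕ) → ℕ → List ℕ → List ℕ × List ℕ
pushStep T x s with avoidsAll T (x ∷ s)
... | true = [] , x ∷ s
pushStep T x [] | false = [] , x ∷ []
pushStep T x (y ∷ s) | false with pushStep T x s
... | (o , s') = y ∷ o , s'

runStack : List (List ℕ) → List ℕ → List ℕ → List ℕ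
runStack T []      s = s
runStack T (x ∷ w) s with pushStep T x s
... | (o , s') = o ++ runStack T w s'

out : List (List ℕ) → List ℕ → List ℕ
out T w = runStack T w []

-- The T-machine: T-stack followed by a classical ({21}-) stack.
machine : List (List ℕ) → List ℕ → List ℕ
machine T w = out ((2 ∷ 1 ∷ []) ∷ []) (out T w)

idPerm : ℕ → List ℕ
idPerm n = map suc (upTo n)

Sortable : List (List ℕ) → ℕ → List ℕ → Set
Sortable T n π = machine T π ≡ idPerm n

-- Left-to-right maxima of a sequence of positive integers (entries larger
-- than all previous entries), in order.
ltrMaxFrom : ℕ → List ℕ → List ℕ
ltrMaxFrom m [] = []
ltrMaxFrom m (x ∷ w) = if m <ᵇ x then x ∷ ltrMaxFrom x w else ltrMaxFrom m w

ltrMaxima : List ℕ → List ℕ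
ltrMaxima = ltrMaxFrom 0

assemble : List ℕ → List (List ℕ) → List ℕ
assemble Ms Bs = concat (zipWith _∷_ Ms Bs)

pat123 pat312 pat213 pat12 : List ℕ
pat123 = 1 ∷ 2 ∷ 3 ∷ []
pat312 = 3 ∷ 1 ∷ 2 ∷ []
pat213 = 2 ∷ 1 ∷ 3 ∷ []
pat12  = 1 ∷ 2 ∷ []

module Submission where

-- While the block B_i is read, the {123,312}-stack holds some content u on top of
-- M_i … M_1, which lie at the bottom in decreasing order and exceed every entry of
-- every block.  Over such a floor, u M_i … M_1 avoids 123 and 312 exactly when u avoids
-- 12, so on B_i the stack runs like a {12}-stack; then M_(i+1) pops all of u, since
-- every y in u forms a 312 with M_(i+1) and M_i.  Hence
-- out^{123,312}(π) = out^{12}(B_1) ⋯ out^{12}(B_t) M_t ⋯ M_1, and (2) follows by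
-- comparing lengths.  That the blocks lie below M_1 comes from sortability: a
-- classical stack sorts only 231-avoiding words, every block entry x is below some
-- M_j, and M_j precedes M_1 in the tail M_t ⋯ M_1 of the output.  For (1), split a
-- block at its minimum, B = L m R; then out^{12}(B) = out^{12}(L) out^{12}(R) m, so an
-- occurrence b a c of 213 in B lies inside L or inside R, or has b in L and c in R and
-- gives the occurrence b c m of 231.

open import Defs
open import Data.Bool using (Bool; true; false; _∧_; not; T)
open import Data.Bool.Properties using (T-∧; T-≡)
open import Data.Empty using (⊥; ⊥-elim)
open import Data.Nat using (ℕ; suc; _<_; _≤_; _<ᵇ_; s<s; z<s)
open import Data.Nat.Induction using (<-wellFounded)
open import Data.Nat.Properties
  using ( <-cmp; <ᵇ-reflects-<; <-asym; <-trans; ≤-trans; <⇒≤; <-≤-trans; ≤-refl; _≤?_; ≰⇒>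
        ; ≤∧≢⇒<; <⇒≢; suc-injective; m<m+n; m≤n+m )
open import Data.List using (List; []; _∷_; _++_; length; concat; map; reverse)
open import Data.List.Properties using (∷-injective; length-++; ++-assoc; ++-identityʳ; unfold-reverse)
open import Data.List.Membership.Propositional using (_∈_; find; lose)
open import Data.List.Membership.Propositional.Properties
  using (∈-∃++; ∈-++⁺ˡ; ∈-++⁺ʳ; ∈-++⁻; ∈-map⁺; ∈-map⁻)
open import Data.List.Relation.Unary.Any using (Any; here; there)
open import Data.List.Relation.Unary.Any.Properties using (any⁺; any⁻) renaming (reverse⁺ to Any-reverse⁺)
open import Data.List.Relation.Unary.All as All using (All; []; _∷_)
open import Data.List.Relation.Unary.All.Properties
  using (all⁺; all⁻) renaming (++⁻ to All-++⁻; ++⁺ to All-++⁺; concat⁻ to All-concat⁻)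
open import Data.List.Relation.Unary.AllPairs as AllPairs using (AllPairs; []; _∷_)
open import Data.List.Relation.Unary.AllPairs.Properties using (applyUpTo⁺₁) renaming (map⁺ to AllPairs-map⁺)
open import Data.List.Relation.Unary.Unique.Propositional using (Unique)
open import Data.List.Relation.Binary.Pointwise using (Pointwise; []; _∷_)
open import Data.List.Relation.Binary.Permutation.Propositional
  using (_↭_; ↭-refl; ↭-sym; ↭-trans; ↭-prep; ↭⇒↭ₛ; module PermutationReasoning)
open import Data.List.Relation.Binary.Permutation.Propositional.Properties
  using (++⁺ˡ; shift; shifts; ∈-resp-↭; ↭-length; All-resp-↭) renaming (++⁺ to ↭-++⁺)
open import Data.List.Relation.Binary.Permutation.Setoid.Properties using (Unique-resp-↭)
open import Data.List.Relation.Binary.Sublist.Propositional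
  using (_⊆_; []; _∷_; _∷ʳ_; ⊆-trans; minimum; to∈; from∈)
open import Data.List.Relation.Binary.Sublist.Propositional.Properties
  using (∷ˡ⁻; ∷⁻; ++⁺; ++⁺ʳ) renaming (++⁺ˡ to ⊆-++⁺ˡ)
open import Data.Product using (_×_; _,_; proj₁; proj₂; ∃; ∃₂; map₁; map₂)
open import Data.Sum using (_⊎_; inj₁; inj₂)
open import Data.Unit using (tt)
open import Function using (_∘_; id)
open import Function.Bundles using (_⇔_; mk⇔; Equivalence)
open import Induction.WellFounded using (Acc; acc)
open import Relation.Binary.Definitions using (tri<; tri≈; tri>)
open import Relation.Binary.PropositionalEquality
open import Relation.Nullary using (¬_; yes; no)
open import Relation.Nullary.Decidable using (T?)
open import Relation.Nullary.Reflects using (ofʸ; ofⁿ)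

open Equivalence using (to; from)

private
  variable
    X : Set

⊆-++⁻ : ∀ (xs : List X) {ys us} → us ⊆ xs ++ ys →
  ∃₂ λ us₁ us₂ → us ≡ us₁ ++ us₂ × us₁ ⊆ xs × us₂ ⊆ ys
⊆-++⁻ []       sub = [] , _ , refl , [] , sub
⊆-++⁻ (x ∷ xs) (.x ∷ʳ sub) with ⊆-++⁻ xs sub
... | us₁ , us₂ , refl , sub₁ , sub₂ = us₁ , us₂ , refl , x ∷ʳ sub₁ , sub₂
⊆-++⁻ (x ∷ xs) (refl ∷ sub) with ⊆-++⁻ xs sub
... | us₁ , us₂ , refl , sub₁ , sub₂ = x ∷ us₁ , us₂ , refl , refl ∷ sub₁ , sub₂

triple-⊆-++⁻ : ∀ {x y z : X} xs {ys} → (x ∷ y ∷ z ∷ []) ⊆ xs ++ ys →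
  (x ∷ y ∷ z ∷ []) ⊆ xs ⊎ ((x ∷ y ∷ []) ⊆ xs × z ∈ ys) ⊎
  (x ∈ xs × (y ∷ z ∷ []) ⊆ ys) ⊎ (x ∷ y ∷ z ∷ []) ⊆ ys
triple-⊆-++⁻ xs sub with ⊆-++⁻ xs sub
... | _ ∷ _ ∷ _ ∷ [] , [] , refl , sub₁ , _ = inj₁ sub₁
... | _ ∷ _ ∷ []     , _  , refl , sub₁ , sub₂ = inj₂ (inj₁ (sub₁ , to∈ sub₂))
... | _ ∷ []         , _  , refl , sub₁ , sub₂ = inj₂ (inj₂ (inj₁ (to∈ sub₁ , sub₂)))
... | []             , _  , refl , _    , sub₂ = inj₂ (inj₂ (inj₂ sub₂))
... | _ ∷ _ ∷ _ ∷ _ ∷ _ , _ , () , _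

∷⊆⇒≢[] : ∀ {x : X} {xs ys} → x ∷ xs ⊆ ys → ys ≢ []
∷⊆⇒≢[] () refl

AllPairs-++⁻ : ∀ {R : X → X → Set} xs {ys} → AllPairs R (xs ++ ys) →
  AllPairs R xs × AllPairs R ys × All (λ x → All (R x) ys) xs
AllPairs-++⁻ []       ps       = [] , ps , []
AllPairs-++⁻ (x ∷ xs) (p ∷ ps) with AllPairs-++⁻ xs ps | All-++⁻ xs p
... | pxs , pys , across | p₁ , p₂ = p₁ ∷ pxs , pys , p₂ ∷ across

reverse-∷-++ : ∀ (x : X) xs ys → reverse (x ∷ xs) ++ ys ≡ reverse xs ++ x ∷ ys
reverse-∷-++ x xs ys = trans (cong (_++ ys) (unfold-reverse x xs)) (++-assoc (reverse xs) (x ∷ []) ys)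

++-cancel-length : ∀ (xs ys : List X) {zs ws} → length xs ≡ length ys → xs ++ zs ≡ ys ++ ws →
  xs ≡ ys × zs ≡ ws
++-cancel-length []       []       _   eq = refl , eq
++-cancel-length (x ∷ xs) (y ∷ ys) len eq with ∷-injective eq
... | refl , eq′ = map₁ (cong (x ∷_)) (++-cancel-length xs ys (suc-injective len) eq′)

concat-↭ : ∀ {xss yss : List (List X)} → Pointwise _↭_ xss yss → concat xss ↭ concat yss
concat-↭ []       = ↭-refl
concat-↭ (p ∷ ps) = ↭-++⁺ p (concat-↭ ps)

Occurs : List ℕ → List ℕ → Set
Occurs w τ = ∃ λ u → u ⊆ w × T (orderIso u τ)

subseqs⁺ : ∀ {u w} → u ⊆ w → u ∈ subseqs w
subseqs⁺ []                   = here refl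
subseqs⁺ {w = y ∷ w} (y ∷ʳ p) = ∈-++⁺ʳ (map (y ∷_) (subseqs w)) (subseqs⁺ p)
subseqs⁺ (refl ∷ p)           = ∈-++⁺ˡ (∈-map⁺ (_ ∷_) (subseqs⁺ p))

subseqs⁻ : ∀ {u} w → u ∈ subseqs w → u ⊆ w
subseqs⁻ []      (here refl) = []
subseqs⁻ (y ∷ w) u∈ with ∈-++⁻ (map (y ∷_) (subseqs w)) u∈
... | inj₂ u∈′ = y ∷ʳ subseqs⁻ w u∈′
... | inj₁ u∈′ with ∈-map⁻ (y ∷_) u∈′
...   | _ , v∈ , refl = refl ∷ subseqs⁻ w v∈

contains⇔Occurs : ∀ {w τ} → T (contains w τ) ⇔ Occurs w τ
contains⇔Occurs {w} {τ} = mk⇔ occurs (λ (u , u⊆w , iso) → any⁺ _ (lose (subseqs⁺ u⊆w) iso))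
  where
  occurs : T (contains w τ) → Occurs w τ
  occurs h with find (any⁻ _ (subseqs w) h)
  ... | u , u∈ , iso = u , subseqs⁻ w u∈ , iso

T-not : ∀ {b} → T (not b) ⇔ (¬ T b)
T-not {true}  = mk⇔ (λ ()) (λ ¬t → ¬t tt)
T-not {false} = mk⇔ (λ _ ()) (λ _ → tt)

avoids⇔¬Occurs : ∀ {w τ} → T (avoids w τ) ⇔ (¬ Occurs w τ)
avoids⇔¬Occurs = mk⇔ (λ ok → to T-not ok ∘ from contains⇔Occurs)
                     (λ ¬occ → from T-not (¬occ ∘ to contains⇔Occurs))

avoidsAll⇔ : ∀ {Ps w} → T (avoidsAll Ps w) ⇔ All (λ τ → ¬ Occurs w τ) Ps
avoidsAll⇔ {Ps} {w} = mk⇔ (All.map (to avoids⇔¬Occurs) ∘ all⁺ (avoids w) Ps)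
                          (all⁻ (avoids w) ∘ All.map (from avoids⇔¬Occurs))

orderIso-length : ∀ u τ → T (orderIso u τ) → length u ≡ length τ
orderIso-length []      []      _   = refl
orderIso-length (_ ∷ u) (_ ∷ τ) iso = cong suc (orderIso-length u τ (proj₂ (to T-∧ iso)))

-- The left-hand side is orderIso on words of length three, unfolded.
∧-regroup : ∀ p q r s t u →
  (p ∧ q ∧ r ∧ s ∧ true) ∧ (t ∧ u ∧ true) ∧ true ≡
  ((p ∧ q ∧ true) ∧ true ∧ true) ∧ ((r ∧ s ∧ true) ∧ true ∧ true) ∧ (t ∧ u ∧ true) ∧ true ∧ true
∧-regroup false _     _     _     _     _     = refl
∧-regroup true  false _     _     _     _     = refl
∧-regroup true  true  false _     _     _     = refl
∧-regroup true  true  true  false _     _     = refl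
∧-regroup true  true  true  true  false _     = refl
∧-regroup true  true  true  true  true  false = refl
∧-regroup true  true  true  true  true  true  = refl

orderIso₃ : ∀ x y z a b c → orderIso (x ∷ y ∷ z ∷ []) (a ∷ b ∷ c ∷ []) ≡
  orderIso (x ∷ y ∷ []) (a ∷ b ∷ []) ∧ orderIso (x ∷ z ∷ []) (a ∷ c ∷ []) ∧
  orderIso (y ∷ z ∷ []) (b ∷ c ∷ [])
orderIso₃ x y z a b c =
  ∧-regroup (cmp x y a b) (cmp y x b a) (cmp x z a c) (cmp z x c a) (cmp y z b c) (cmp z y c b)
  where
  cmp : ℕ → ℕ → ℕ → ℕ → Bool
  cmp x y a b = (x <ᵇ y) ==ᵇ (a <ᵇ b)

<ᵇ-true : ∀ {a b} → a < b → (a <ᵇ b) ≡ true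
<ᵇ-true {a} {b} a<b with a <ᵇ b | <ᵇ-reflects-< a b
... | true  | _       = refl
... | false | ofⁿ a≮b = ⊥-elim (a≮b a<b)

<ᵇ-false : ∀ {a b} → ¬ a < b → (a <ᵇ b) ≡ false
<ᵇ-false {a} {b} a≮b with a <ᵇ b | <ᵇ-reflects-< a b
... | true  | ofʸ a<b = ⊥-elim (a≮b a<b)
... | false | _       = refl

orderIso-< : ∀ {x y a b} → a < b → T (orderIso (x ∷ y ∷ []) (a ∷ b ∷ [])) ⇔ x < y
orderIso-< {x} {y} a<b rewrite <ᵇ-true a<b | <ᵇ-false (<-asym a<b)
  with x <ᵇ y | <ᵇ-reflects-< x y | y <ᵇ x | <ᵇ-reflects-< y x
... | true  | ofʸ x<y | false | _       = mk⇔ (λ _ → x<y) _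
... | true  | ofʸ x<y | true  | ofʸ y<x = mk⇔ (λ ()) (λ _ → <-asym x<y y<x)
... | false | ofⁿ x≮y | _     | _       = mk⇔ (λ ()) x≮y

orderIso-> : ∀ {x y a b} → b < a → T (orderIso (x ∷ y ∷ []) (a ∷ b ∷ [])) ⇔ y < x
orderIso-> {x} {y} b<a rewrite <ᵇ-true b<a | <ᵇ-false (<-asym b<a)
  with x <ᵇ y | <ᵇ-reflects-< x y | y <ᵇ x | <ᵇ-reflects-< y x
... | true  | ofʸ x<y | _     | _       = mk⇔ (λ ()) (<-asym x<y)
... | false | _       | true  | ofʸ y<x = mk⇔ (λ _ → y<x) _
... | false | _       | false | ofⁿ y≮x = mk⇔ (λ ()) y≮x

Occurs-pair⁻ : ∀ {w a b} → Occurs w (a ∷ b ∷ []) →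
  ∃₂ λ x y → (x ∷ y ∷ []) ⊆ w × T (orderIso (x ∷ y ∷ []) (a ∷ b ∷ []))
Occurs-pair⁻ (x ∷ y ∷ [] , sub , iso) = x , y , sub , iso
Occurs-pair⁻ {a = a} {b} (u@(_ ∷ _ ∷ _ ∷ _) , _ , iso) with () ← orderIso-length u (a ∷ b ∷ []) iso

Occurs-triple⁻ : ∀ {w a b c} → Occurs w (a ∷ b ∷ c ∷ []) →
  ∃ λ x → ∃₂ λ y z → (x ∷ y ∷ z ∷ []) ⊆ w × T (orderIso (x ∷ y ∷ []) (a ∷ b ∷ []))
    × T (orderIso (x ∷ z ∷ []) (a ∷ c ∷ [])) × T (orderIso (y ∷ z ∷ []) (b ∷ c ∷ []))
Occurs-triple⁻ {a = a} {b} {c} (x ∷ y ∷ z ∷ [] , sub , iso) rewrite orderIso₃ x y z a b c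
  with to T-∧ iso
... | xy , xz∧yz with to T-∧ xz∧yz
...   | xz , yz = x , y , z , sub , xy , xz , yz
Occurs-triple⁻ {a = a} {b} {c} (u@(_ ∷ _ ∷ []) , _ , iso)
  with () ← orderIso-length u (a ∷ b ∷ c ∷ []) iso
Occurs-triple⁻ {a = a} {b} {c} (u@(_ ∷ _ ∷ _ ∷ _ ∷ _) , _ , iso)
  with () ← orderIso-length u (a ∷ b ∷ c ∷ []) iso

Occurs-triple⁺ : ∀ {w a b c x y z} → (x ∷ y ∷ z ∷ []) ⊆ w →
  T (orderIso (x ∷ y ∷ []) (a ∷ b ∷ [])) → T (orderIso (x ∷ z ∷ []) (a ∷ c ∷ [])) →
  T (orderIso (y ∷ z ∷ []) (b ∷ c ∷ [])) → Occurs w (a ∷ b ∷ c ∷ [])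
Occurs-triple⁺ {a = a} {b} {c} {x} {y} {z} sub xy xz yz =
  _ , sub , subst T (sym (orderIso₃ x y z a b c)) (from T-∧ (xy , from T-∧ (xz , yz)))

1<2 : 1 < 2
1<2 = s<s z<s

2<3 : 2 < 3
2<3 = s<s 1<2

pat21 : List ℕ
pat21 = 2 ∷ 1 ∷ []

Ascent : List ℕ → Set
Ascent w = ∃₂ λ x y → x < y × (x ∷ y ∷ []) ⊆ w

Occurs-12⇔Ascent : ∀ {w} → Occurs w pat12 ⇔ Ascent w
Occurs-12⇔Ascent = mk⇔
  (λ occ → let x , y , sub , iso = Occurs-pair⁻ occ in x , y , to (orderIso-< 1<2) iso , sub)
  (λ (x , y , x<y , sub) → _ , sub , from (orderIso-< 1<2) x<y)

Occurs-21⁺ : ∀ {w x y} → y < x → (x ∷ y ∷ []) ⊆ w → Occurs w pat21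
Occurs-21⁺ y<x sub = _ , sub , from (orderIso-> 1<2) y<x

Occurs-123⁺ : ∀ {w x y z} → x < y → y < z → (x ∷ y ∷ z ∷ []) ⊆ w → Occurs w pat123
Occurs-123⁺ x<y y<z sub = Occurs-triple⁺ sub (from (orderIso-< 1<2) x<y)
  (from (orderIso-< 1<2) (<-trans x<y y<z)) (from (orderIso-< 2<3) y<z)

Occurs-123⁻ : ∀ {w} → Occurs w pat123 →
  ∃ λ x → ∃₂ λ y z → x < y × y < z × (x ∷ y ∷ z ∷ []) ⊆ w
Occurs-123⁻ occ with Occurs-triple⁻ occ
... | x , y , z , sub , xy , _ , yz = x , y , z , to (orderIso-< 1<2) xy , to (orderIso-< 2<3) yz , sub

Occurs-312⁺ : ∀ {w x y z} → y < z → z < x → (x ∷ y ∷ z ∷ []) ⊆ w → Occurs w pat312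
Occurs-312⁺ y<z z<x sub = Occurs-triple⁺ sub (from (orderIso-> 1<2) (<-trans y<z z<x))
  (from (orderIso-> 2<3) z<x) (from (orderIso-< 1<2) y<z)

Occurs-312⁻ : ∀ {w} → Occurs w pat312 →
  ∃ λ x → ∃₂ λ y z → y < z × z < x × (x ∷ y ∷ z ∷ []) ⊆ w
Occurs-312⁻ occ with Occurs-triple⁻ occ
... | x , y , z , sub , _ , xz , yz = x , y , z , to (orderIso-< 1<2) yz , to (orderIso-> 2<3) xz , sub

Occurs-213⁻ : ∀ {w} → Occurs w pat213 →
  ∃ λ x → ∃₂ λ y z → y < x × x < z × (x ∷ y ∷ z ∷ []) ⊆ w
Occurs-213⁻ occ with Occurs-triple⁻ occ
... | x , y , z , sub , xy , xz , _ = x , y , z , to (orderIso-> 1<2) xy , to (orderIso-< 1<2) xz , sub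

¬Ascent-[] : ¬ Ascent []
¬Ascent-[] (_ , _ , _ , ())

¬Ascent-∷ : ∀ {M F} → All (_< M) F → ¬ Ascent F → ¬ Ascent (M ∷ F)
¬Ascent-∷ F<M ¬asc (x , y , x<y , refl ∷ sub) = <-asym x<y (All.lookup F<M (to∈ sub))
¬Ascent-∷ F<M ¬asc (x , y , x<y , _ ∷ʳ sub)   = ¬asc (x , y , x<y , sub)

Ascent-∷ʳ-min⁻ : ∀ {m} A → All (m <_) A → Ascent (A ++ m ∷ []) → Ascent A
Ascent-∷ʳ-min⁻ A m<A (x , y , x<y , sub) with ⊆-++⁻ A sub
... | _ ∷ _ ∷ [] , []     , refl , sub₁ , _        = x , y , x<y , sub₁
... | _ ∷ []     , _ ∷ [] , refl , sub₁ , refl ∷ _ = ⊥-elim (<-asym x<y (All.lookup m<A (to∈ sub₁)))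
... | _ ∷ []     , _ ∷ [] , refl , _    , _ ∷ʳ ()
... | []         , _      , refl , _    , _ ∷ ()
... | []         , _      , refl , _    , _ ∷ʳ ()
... | _ ∷ _ ∷ _ ∷ _ , _ , () , _

P₁₂ P₂₁ P₁₂₃₋₃₁₂ : List (List ℕ)
P₁₂      = pat12 ∷ []
P₂₁      = pat21 ∷ []
P₁₂₃₋₃₁₂ = pat123 ∷ pat312 ∷ []

avoidsAll-P₁₂⇔ : ∀ {w} → T (avoidsAll P₁₂ w) ⇔ (¬ Ascent w)
avoidsAll-P₁₂⇔ = mk⇔ (λ ok → All.head (to (avoidsAll⇔ {P₁₂}) ok) ∘ from Occurs-12⇔Ascent)
                     (λ ¬asc → from avoidsAll⇔ ((¬asc ∘ to Occurs-12⇔Ascent) ∷ []))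

avoidsAll-P₁₂₃₋₃₁₂⇔ : ∀ {w} →
  T (avoidsAll P₁₂₃₋₃₁₂ w) ⇔ (¬ Occurs w pat123 × ¬ Occurs w pat312)
avoidsAll-P₁₂₃₋₃₁₂⇔ = mk⇔ (split ∘ to (avoidsAll⇔ {P₁₂₃₋₃₁₂}))
                          (λ (¬123 , ¬312) → from avoidsAll⇔ (¬123 ∷ ¬312 ∷ []))
  where
  split : ∀ {w} → All (λ τ → ¬ Occurs w τ) P₁₂₃₋₃₁₂ → ¬ Occurs w pat123 × ¬ Occurs w pat312
  split (¬123 ∷ ¬312 ∷ []) = ¬123 , ¬312

¬Ascent⇒avoids-P₁₂₃₋₃₁₂ : ∀ {w} → ¬ Ascent w → T (avoidsAll P₁₂₃₋₃₁₂ w)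
¬Ascent⇒avoids-P₁₂₃₋₃₁₂ ¬asc = from avoidsAll-P₁₂₃₋₃₁₂⇔ (¬123 , ¬312)
  where
  ¬123 : ¬ Occurs _ pat123
  ¬123 occ with Occurs-123⁻ occ
  ... | x , y , z , x<y , _ , sub = ¬asc (x , y , x<y , ⊆-trans (refl ∷ refl ∷ z ∷ʳ []) sub)
  ¬312 : ¬ Occurs _ pat312
  ¬312 occ with Occurs-312⁻ occ
  ... | _ , y , z , y<z , _ , sub = ¬asc (y , z , y<z , ∷ˡ⁻ sub)

feed : List (List ℕ) → List ℕ → List ℕ → List ℕ × List ℕ
feed Ps []      s = [] , s
feed Ps (x ∷ w) s with pushStep Ps x s
... | o , s′ = map₁ (o ++_) (feed Ps w s′)

module _ {Ps : List (List ℕ)} where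

  pushStep-accept : ∀ {x s} → T (avoidsAll Ps (x ∷ s)) → pushStep Ps x s ≡ ([] , x ∷ s)
  pushStep-accept {x} {s} ok with avoidsAll Ps (x ∷ s)
  ... | true = refl

  pushStep-reject : ∀ {x y s} → ¬ T (avoidsAll Ps (x ∷ y ∷ s)) →
    pushStep Ps x (y ∷ s) ≡ map₁ (y ∷_) (pushStep Ps x s)
  pushStep-reject {x} {y} {s} ¬ok with avoidsAll Ps (x ∷ y ∷ s)
  ... | true  = ⊥-elim (¬ok tt)
  ... | false with pushStep Ps x s
  ...   | _ = refl

  pushStep-[] : ∀ {x} → pushStep Ps x [] ≡ ([] , x ∷ [])
  pushStep-[] {x} with avoidsAll Ps (x ∷ [])
  ... | true  = refl
  ... | false = refl

  pushStep-pops-prefix : ∀ x s → ∃₂ λ o r → pushStep Ps x s ≡ (o , x ∷ r) × s ≡ o ++ r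
  pushStep-pops-prefix x []      = [] , [] , pushStep-[] , refl
  pushStep-pops-prefix x (y ∷ s) with T? (avoidsAll Ps (x ∷ y ∷ s))
  ... | yes ok = [] , y ∷ s , pushStep-accept ok , refl
  ... | no ¬ok with pushStep-pops-prefix x s
  ...   | o , r , eq , refl = y ∷ o , r , trans (pushStep-reject ¬ok) (cong (map₁ (y ∷_)) eq) , refl

  runStack-∷ : ∀ x w s →
    runStack Ps (x ∷ w) s ≡ proj₁ (pushStep Ps x s) ++ runStack Ps w (proj₂ (pushStep Ps x s))
  runStack-∷ x w s with pushStep Ps x s
  ... | _ = refl

  runStack-∷-[] : ∀ x w → runStack Ps (x ∷ w) [] ≡ runStack Ps w (x ∷ [])
  runStack-∷-[] x w =
    trans (runStack-∷ x w []) (cong (λ p → proj₁ p ++ runStack Ps w (proj₂ p)) pushStep-[])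

  runStack-↭ : ∀ w s → runStack Ps w s ↭ w ++ s
  runStack-↭ []      s = ↭-refl
  runStack-↭ (x ∷ w) s with pushStep-pops-prefix x s
  ... | o , r , eq , refl = begin
    runStack Ps (x ∷ w) (o ++ r)
      ≡⟨ trans (runStack-∷ x w _) (cong (λ p → proj₁ p ++ runStack Ps w (proj₂ p)) eq) ⟩
    o ++ runStack Ps w (x ∷ r)  ↭⟨ ++⁺ˡ o (runStack-↭ w (x ∷ r)) ⟩
    o ++ w ++ x ∷ r             ↭⟨ shifts o w ⟩
    w ++ o ++ x ∷ r             ↭⟨ ++⁺ˡ w (shift x o r) ⟩
    w ++ x ∷ o ++ r             ↭⟨ shift x w (o ++ r) ⟩
    x ∷ w ++ o ++ r             ∎
    where open PermutationReasoning

  ∈-runStack : ∀ {x} w s → x ∈ w → x ∈ runStack Ps w s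
  ∈-runStack w s x∈ = ∈-resp-↭ (↭-sym (runStack-↭ w s)) (∈-++⁺ˡ x∈)

  runStack-++ : ∀ w C s →
    runStack Ps (w ++ C) s ≡ proj₁ (feed Ps w s) ++ runStack Ps C (proj₂ (feed Ps w s))
  runStack-++ []      C s = refl
  runStack-++ (x ∷ w) C s with pushStep Ps x s
  ... | o , s′ = trans (cong (o ++_) (runStack-++ w C s′)) (sym (++-assoc o _ _))

  runStack-feed : ∀ w s → runStack Ps w s ≡ proj₁ (feed Ps w s) ++ proj₂ (feed Ps w s)
  runStack-feed w s = trans (cong (λ v → runStack Ps v s) (sym (++-identityʳ w))) (runStack-++ w [] s)

  feed-stack∈ : ∀ {y} w s → y ∈ proj₂ (feed Ps w s) → y ∈ w ++ s
  feed-stack∈ w s y∈ =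
    ∈-resp-↭ (runStack-↭ w s) (subst (_ ∈_) (sym (runStack-feed w s)) (∈-++⁺ʳ _ y∈))

  runStack-pops-all : ∀ {x F} w s → T (avoidsAll Ps (x ∷ F)) →
    All (λ y → ∀ t → ¬ T (avoidsAll Ps (x ∷ y ∷ t ++ F))) s →
    runStack Ps (x ∷ w) (s ++ F) ≡ s ++ runStack Ps w (x ∷ F)
  runStack-pops-all {x} {F} w s ok rejected =
    trans (runStack-∷ x w (s ++ F)) (cong (λ p → proj₁ p ++ runStack Ps w (proj₂ p)) (pops s rejected))
    where
    pops : ∀ s → All (λ y → ∀ t → ¬ T (avoidsAll Ps (x ∷ y ∷ t ++ F))) s →
      pushStep Ps x (s ++ F) ≡ (s , x ∷ F)
    pops []      []           = pushStep-accept ok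
    pops (y ∷ s) (rej ∷ rejs) = trans (pushStep-reject (rej s)) (cong (map₁ (y ∷_)) (pops s rejs))

  Evicts : ℕ → ℕ → Set
  Evicts x y = ∀ t → y ∈ t → ¬ T (avoidsAll Ps (x ∷ t))

  pushStep-evicts : ∀ {x y} s → Evicts x y → y ∈ s → y ∈ proj₁ (pushStep Ps x s)
  pushStep-evicts {x} (z ∷ s) evicts y∈ rewrite pushStep-reject {x} {z} {s} (evicts (z ∷ s) y∈)
    with y∈
  ... | here y≡z  = here y≡z
  ... | there y∈s = there (pushStep-evicts s evicts y∈s)

  feed-evicts : ∀ {x y} A s → Evicts x y → y ∈ A ++ s → y ∈ proj₁ (feed Ps (A ++ x ∷ []) s)
  feed-evicts {x} [] s evicts y∈ with pushStep Ps x s | pushStep-evicts s evicts y∈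
  ... | _ | y∈o = ∈-++⁺ˡ y∈o
  feed-evicts {x} {y} (a ∷ A) s evicts y∈ with pushStep Ps a s | pushStep-pops-prefix a s
  ... | _ | o , r , refl , refl = popped y∈
    where
    later : y ∈ A ++ a ∷ r → y ∈ o ++ proj₁ (feed Ps (A ++ x ∷ []) (a ∷ r))
    later = ∈-++⁺ʳ o ∘ feed-evicts A (a ∷ r) evicts
    popped : y ∈ a ∷ A ++ o ++ r → y ∈ o ++ proj₁ (feed Ps (A ++ x ∷ []) (a ∷ r))
    popped (here refl) = later (∈-++⁺ʳ A (here refl))
    popped (there y∈) with ∈-++⁻ A y∈
    ... | inj₁ y∈A = later (∈-++⁺ˡ y∈A)
    ... | inj₂ y∈or with ∈-++⁻ o y∈or
    ...   | inj₁ y∈o = ∈-++⁺ˡ y∈o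
    ...   | inj₂ y∈r = later (∈-++⁺ʳ A (there y∈r))

-- Stacks over a floor

-- Stack content F that is never popped: on entries that are Below it, a Ps-stack
-- standing on F runs exactly like a Qs-stack.
module Floor {Ps Qs : List (List ℕ)} {F : List ℕ} (Below : ℕ → Set)
  (agree : ∀ {A} → All Below A → T (avoidsAll Ps (A ++ F)) ⇔ T (avoidsAll Qs A))
  (singleton : ∀ {x} → T (avoidsAll Qs (x ∷ [])))
  where

  pushStep-floor : ∀ {x} u → Below x → All Below u →
    pushStep Ps x (u ++ F) ≡ map₂ (_++ F) (pushStep Qs x u)
  pushStep-floor {x} [] bx [] rewrite pushStep-[] {Qs} {x} =
    pushStep-accept (from (agree (bx ∷ [])) singleton)
  pushStep-floor {x} (y ∷ u) bx (by ∷ bu) with T? (avoidsAll Qs (x ∷ y ∷ u))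
  ... | yes ok = trans (pushStep-accept (from (agree (bx ∷ by ∷ bu)) ok))
                       (sym (cong (map₂ (_++ F)) (pushStep-accept {Qs} {x} {y ∷ u} ok)))
  ... | no ¬ok = begin
    pushStep Ps x (y ∷ u ++ F)
      ≡⟨ pushStep-reject (¬ok ∘ to (agree (bx ∷ by ∷ bu))) ⟩
    map₁ (y ∷_) (pushStep Ps x (u ++ F))
      ≡⟨ cong (map₁ (y ∷_)) (pushStep-floor u bx bu) ⟩
    map₂ (_++ F) (map₁ (y ∷_) (pushStep Qs x u))
      ≡⟨ cong (map₂ (_++ F)) (pushStep-reject {Qs} {x} {y} {u} ¬ok) ⟨
    map₂ (_++ F) (pushStep Qs x (y ∷ u))
      ∎
    where open ≡-Reasoning

  feed-floor : ∀ w u → All Below w → All Below u → feed Ps w (u ++ F) ≡ map₂ (_++ F) (feed Qs w u)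
  feed-floor []      u _         _  = refl
  feed-floor (x ∷ w) u (bx ∷ bw) bu rewrite pushStep-floor u bx bu
    with pushStep Qs x u | pushStep-pops-prefix {Qs} x u
  ... | _ | o , r , refl , refl = cong (map₁ (o ++_)) (feed-floor w (x ∷ r) bw (bx ∷ proj₂ (All-++⁻ o bu)))

  runStack-++-floor : ∀ w C → All Below w →
    runStack Ps (w ++ C) F ≡ proj₁ (feed Qs w []) ++ runStack Ps C (proj₂ (feed Qs w []) ++ F)
  runStack-++-floor w C bw =
    trans (runStack-++ w C F) (cong (λ p → proj₁ p ++ runStack Ps C (proj₂ p)) (feed-floor w [] bw []))

  runStack-floor : ∀ w → All Below w → runStack Ps w F ≡ runStack Qs w [] ++ F
  runStack-floor w bw = begin
    runStack Ps w F        ≡⟨ runStack-feed w F ⟩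
    proj₁ (feed Ps w F) ++ proj₂ (feed Ps w F)
                           ≡⟨ cong (λ p → proj₁ p ++ proj₂ p) (feed-floor w [] bw []) ⟩
    o ++ s ++ F            ≡⟨ ++-assoc o s F ⟨
    (o ++ s) ++ F          ≡⟨ cong (_++ F) (runStack-feed w []) ⟨
    runStack Qs w [] ++ F  ∎
    where
    open ≡-Reasoning
    o = proj₁ (feed Qs w [])
    s = proj₂ (feed Qs w [])

module DecreasingFloor {v : ℕ} {V : List ℕ} (¬asc : ¬ Ascent (v ∷ V)) where

  Below : ℕ → Set
  Below x = All (x <_) (v ∷ V)

  P₁₂₃₋₃₁₂-agrees-P₁₂ : ∀ {A} → All Below A →
    T (avoidsAll P₁₂₃₋₃₁₂ (A ++ v ∷ V)) ⇔ T (avoidsAll P₁₂ A)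
  P₁₂₃₋₃₁₂-agrees-P₁₂ {A} below = mk⇔
    (λ ok → from avoidsAll-P₁₂⇔ λ (x , y , x<y , sub) → proj₁ (to avoidsAll-P₁₂₃₋₃₁₂⇔ ok)
      (Occurs-123⁺ x<y (All.head (All.lookup below (to∈ (∷ˡ⁻ sub)))) (++⁺ sub (refl ∷ minimum V))))
    (λ ok → let ¬ascA = to avoidsAll-P₁₂⇔ ok in
            from avoidsAll-P₁₂₃₋₃₁₂⇔ (¬123 ¬ascA , ¬312 ¬ascA))
    where
    ¬123 : ¬ Ascent A → ¬ Occurs (A ++ v ∷ V) pat123
    ¬123 ¬ascA occ with Occurs-123⁻ occ
    ... | x , y , z , x<y , y<z , sub with triple-⊆-++⁻ A sub
    ...   | inj₁ sub₁                     = ¬ascA (x , y , x<y , ⊆-trans (refl ∷ refl ∷ z ∷ʳ []) sub₁)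
    ...   | inj₂ (inj₁ (sub₁ , _))        = ¬ascA (x , y , x<y , sub₁)
    ...   | inj₂ (inj₂ (inj₁ (_ , sub₂))) = ¬asc (y , z , y<z , sub₂)
    ...   | inj₂ (inj₂ (inj₂ sub₂))       = ¬asc (y , z , y<z , ∷ˡ⁻ sub₂)
    ¬312 : ¬ Ascent A → ¬ Occurs (A ++ v ∷ V) pat312
    ¬312 ¬ascA occ with Occurs-312⁻ occ
    ... | x , y , z , y<z , z<x , sub with triple-⊆-++⁻ A sub
    ...   | inj₁ sub₁                     = ¬ascA (y , z , y<z , ∷ˡ⁻ sub₁)
    ...   | inj₂ (inj₁ (sub₁ , z∈))       = <-asym z<x (All.lookup (All.lookup below (to∈ sub₁)) z∈)
    ...   | inj₂ (inj₂ (inj₁ (_ , sub₂))) = ¬asc (y , z , y<z , sub₂)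
    ...   | inj₂ (inj₂ (inj₂ sub₂))       = ¬asc (y , z , y<z , ∷ˡ⁻ sub₂)

  open Floor {P₁₂₃₋₃₁₂} {P₁₂} {v ∷ V} Below P₁₂₃₋₃₁₂-agrees-P₁₂ tt public

  runStack-new-maximum : ∀ {M} w s → All (_< M) (v ∷ V) → All (_< v) s →
    runStack P₁₂₃₋₃₁₂ (M ∷ w) (s ++ v ∷ V) ≡ s ++ runStack P₁₂₃₋₃₁₂ w (M ∷ v ∷ V)
  runStack-new-maximum {M} w s F<M s<v =
    runStack-pops-all w s (¬Ascent⇒avoids-P₁₂₃₋₃₁₂ (¬Ascent-∷ F<M ¬asc)) (All.map rejects s<v)
    where
    rejects : ∀ {y} → y < v → ∀ t → ¬ T (avoidsAll P₁₂₃₋₃₁₂ (M ∷ y ∷ t ++ v ∷ V))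
    rejects y<v t ok = proj₂ (to avoidsAll-P₁₂₃₋₃₁₂⇔ ok)
      (Occurs-312⁺ y<v (All.head F<M) (refl ∷ refl ∷ ⊆-++⁺ˡ t (refl ∷ minimum V)))

module MinimumFloor {m : ℕ} where

  P₁₂-agrees-P₁₂ : ∀ {A} → All (m <_) A →
    T (avoidsAll P₁₂ (A ++ m ∷ [])) ⇔ T (avoidsAll P₁₂ A)
  P₁₂-agrees-P₁₂ {A} m<A = mk⇔
    (λ ok → from avoidsAll-P₁₂⇔ λ (x , y , x<y , sub) →
      to (avoidsAll-P₁₂⇔ {A ++ m ∷ []}) ok (x , y , x<y , ++⁺ʳ (m ∷ []) sub))
    (λ ok → from avoidsAll-P₁₂⇔ (to avoidsAll-P₁₂⇔ ok ∘ Ascent-∷ʳ-min⁻ A m<A))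

  open Floor {P₁₂} {P₁₂} {m ∷ []} (m <_) P₁₂-agrees-P₁₂ tt public

-- 231-avoidance

-- z ≤ x < p is excluded, not only z < x < p; on words without repetitions this is
-- the usual avoidance of 231.
Avoids231 : List ℕ → Set
Avoids231 w = ∀ {A p C x z} → w ≡ A ++ p ∷ C → x ∈ A → z ∈ C → x < p → x < z

Avoids231-++ˡ : ∀ X {Y} → Avoids231 (X ++ Y) → Avoids231 X
Avoids231-++ˡ _ {Y} av {A} {p} {C} refl x∈ z∈ = av (++-assoc A (p ∷ C) Y) x∈ (∈-++⁺ˡ z∈)

Avoids231-++ʳ : ∀ X {Y} → Avoids231 (X ++ Y) → Avoids231 Y
Avoids231-++ʳ X av {A} {p} {C} refl x∈ = av (sym (++-assoc X A (p ∷ C))) (∈-++⁺ʳ X x∈)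

Avoids231-across : ∀ X {Y Z x p z} → Avoids231 (X ++ Y ++ Z) →
  x ∈ X → p ∈ Y → z ∈ Z → x < p → x < z
Avoids231-across X {Y} {Z} {p = p} av x∈X p∈Y z∈Z with ∈-∃++ p∈Y
... | P , Q , refl = av (begin
  X ++ (P ++ p ∷ Q) ++ Z   ≡⟨ cong (X ++_) (++-assoc P (p ∷ Q) Z) ⟩
  X ++ P ++ p ∷ Q ++ Z     ≡⟨ ++-assoc X P _ ⟨
  (X ++ P) ++ p ∷ Q ++ Z   ∎) (∈-++⁺ˡ x∈X) (∈-++⁺ʳ Q z∈Z)
  where open ≡-Reasoning

stack-sorted⇒Avoids231 : ∀ {w} → AllPairs _<_ (out P₂₁ w) → Avoids231 w
stack-sorted⇒Avoids231 sorted {A} {p} {C} {x} {z} refl x∈A z∈C x<p =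
  All.lookup (All.lookup (proj₂ (proj₂ (AllPairs-++⁻ popped sorted′))) x-popped) z-later
  where
  popped = proj₁ (feed P₂₁ (A ++ p ∷ []) [])
  later = runStack P₂₁ C (proj₂ (feed P₂₁ (A ++ p ∷ []) []))
  sorted′ : AllPairs _<_ (popped ++ later)
  sorted′ = subst (AllPairs _<_)
    (trans (cong (out P₂₁) (sym (++-assoc A (p ∷ []) C))) (runStack-++ (A ++ p ∷ []) C [])) sorted
  evicts : Evicts {P₂₁} p x
  evicts t x∈t ok = All.head (to (avoidsAll⇔ {P₂₁}) ok) (Occurs-21⁺ x<p (refl ∷ from∈ x∈t))
  x-popped : x ∈ popped
  x-popped = feed-evicts A [] evicts (∈-++⁺ˡ x∈A)
  z-later : z ∈ later
  z-later = ∈-runStack C _ z∈C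

-- The {123,312}-stack on the left-to-right maxima decomposition

-- The stack between two blocks: the floor F = M_i ⋯ M_1, the maxima Ms still to
-- come, and a bound c (namely M_1) above every block entry.
record MaximaFloor (c : ℕ) (F Ms : List ℕ) : Set where
  field
    floor-no-ascent   : ¬ Ascent F
    c≤floor           : All (c ≤_) F
    maxima-increasing : AllPairs _<_ Ms
    floor<maxima      : All (λ M → All (_< M) F) Ms

open MaximaFloor

push-maximum : ∀ {c M′ M V Ms} → MaximaFloor c (M ∷ V) (M′ ∷ Ms) → MaximaFloor c (M′ ∷ M ∷ V) Ms
push-maximum inv@record { maxima-increasing = M′<Ms ∷ Ms↑ ; floor<maxima = F<M′ ∷ F<Ms } = record
  { floor-no-ascent   = ¬Ascent-∷ F<M′ (floor-no-ascent inv)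
  ; c≤floor           = ≤-trans (All.head (c≤floor inv)) (<⇒≤ (All.head F<M′)) ∷ c≤floor inv
  ; maxima-increasing = Ms↑
  ; floor<maxima      = All.zipWith (λ (M′<M , F<M) → M′<M ∷ F<M) (M′<Ms , F<Ms)
  }

runStack-block : ∀ {c M V} B Ms Bs → length Bs ≡ length Ms → MaximaFloor c (M ∷ V) Ms →
  All (_< c) B → All (All (_< c)) Bs →
  runStack P₁₂₃₋₃₁₂ (B ++ assemble Ms Bs) (M ∷ V) ≡
  out P₁₂ B ++ concat (map (out P₁₂) Bs) ++ reverse Ms ++ M ∷ V

runStack-after-block : ∀ {c M V} Ms Bs s → length Bs ≡ length Ms → MaximaFloor c (M ∷ V) Ms →
  All (_< c) s → All (All (_< c)) Bs →
  runStack P₁₂₃₋₃₁₂ (assemble Ms Bs) (s ++ M ∷ V) ≡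
  s ++ concat (map (out P₁₂) Bs) ++ reverse Ms ++ M ∷ V

runStack-block {c} {M} {V} B Ms Bs len inv B<c Bs<c = begin
  runStack P₁₂₃₋₃₁₂ (B ++ assemble Ms Bs) (M ∷ V)
    ≡⟨ runStack-++-floor B _ (All.map below B<c) ⟩
  o ++ runStack P₁₂₃₋₃₁₂ (assemble Ms Bs) (s ++ M ∷ V)
    ≡⟨ cong (o ++_) (runStack-after-block Ms Bs s len inv s<c Bs<c) ⟩
  o ++ s ++ rest
    ≡⟨ ++-assoc o s rest ⟨
  (o ++ s) ++ rest
    ≡⟨ cong (_++ rest) (runStack-feed B []) ⟨
  out P₁₂ B ++ rest
    ∎
  where
  open ≡-Reasoning
  open DecreasingFloor (floor-no-ascent inv)
  o = proj₁ (feed P₁₂ B [])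
  s = proj₂ (feed P₁₂ B [])
  rest = concat (map (out P₁₂) Bs) ++ reverse Ms ++ M ∷ V
  below : ∀ {x} → x < c → Below x
  below x<c = All.map (<-≤-trans x<c) (c≤floor inv)
  s<c : All (_< c) s
  s<c = All.tabulate (All.lookup (All-++⁺ B<c []) ∘ feed-stack∈ B [])

runStack-after-block []        []        s _ _ _ _ = refl
runStack-after-block {c} {M} {V} (M′ ∷ Ms) (B′ ∷ Bs) s len inv s<c (B′<c ∷ Bs<c) = begin
  runStack P₁₂₃₋₃₁₂ (M′ ∷ B′ ++ assemble Ms Bs) (s ++ M ∷ V)
    ≡⟨ runStack-new-maximum (B′ ++ assemble Ms Bs) s (All.head (floor<maxima inv)) s<M ⟩
  s ++ runStack P₁₂₃₋₃₁₂ (B′ ++ assemble Ms Bs) (M′ ∷ M ∷ V)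
    ≡⟨ cong (s ++_) (runStack-block B′ Ms Bs (suc-injective len) (push-maximum inv) B′<c Bs<c) ⟩
  s ++ out P₁₂ B′ ++ concat (map (out P₁₂) Bs) ++ reverse Ms ++ M′ ∷ M ∷ V
    ≡⟨ cong (λ r → s ++ out P₁₂ B′ ++ concat (map (out P₁₂) Bs) ++ r) (reverse-∷-++ M′ Ms _) ⟨
  s ++ out P₁₂ B′ ++ concat (map (out P₁₂) Bs) ++ reverse (M′ ∷ Ms) ++ M ∷ V
    ≡⟨ cong (s ++_) (++-assoc (out P₁₂ B′) _ _) ⟨
  s ++ (out P₁₂ B′ ++ concat (map (out P₁₂) Bs)) ++ reverse (M′ ∷ Ms) ++ M ∷ V ∎
  where
  open ≡-Reasoning
  open DecreasingFloor (floor-no-ascent inv)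
  s<M : All (_< M) s
  s<M = All.map (λ y<c → <-≤-trans y<c (All.head (c≤floor inv))) s<c

out-assemble : ∀ Ms Bs → length Bs ≡ length Ms → AllPairs _<_ Ms →
  All (λ x → All (x <_) Ms) (concat Bs) →
  out P₁₂₃₋₃₁₂ (assemble Ms Bs) ≡ concat (map (out P₁₂) Bs) ++ reverse Ms
out-assemble []       []       _   _            _     = refl
out-assemble (M ∷ Ms) (B ∷ Bs) len (M<Ms ∷ Ms↑) below = begin
  runStack P₁₂₃₋₃₁₂ (M ∷ B ++ assemble Ms Bs) []
    ≡⟨ runStack-∷-[] M (B ++ assemble Ms Bs) ⟩
  runStack P₁₂₃₋₃₁₂ (B ++ assemble Ms Bs) (M ∷ [])
    ≡⟨ runStack-block B Ms Bs (suc-injective len) floor (All.head blocks<M) (All.tail blocks<M) ⟩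
  out P₁₂ B ++ concat (map (out P₁₂) Bs) ++ reverse Ms ++ M ∷ []
    ≡⟨ ++-assoc (out P₁₂ B) _ _ ⟨
  (out P₁₂ B ++ concat (map (out P₁₂) Bs)) ++ reverse Ms ++ M ∷ []
    ≡⟨ cong (_ ++_) (unfold-reverse M Ms) ⟨
  (out P₁₂ B ++ concat (map (out P₁₂) Bs)) ++ reverse (M ∷ Ms) ∎
  where
  open ≡-Reasoning
  floor : MaximaFloor M (M ∷ []) Ms
  floor = record
    { floor-no-ascent   = ¬Ascent-∷ [] ¬Ascent-[]
    ; c≤floor           = ≤-refl ∷ []
    ; maxima-increasing = Ms↑
    ; floor<maxima      = All.map (_∷ []) M<Ms
    }
  blocks<M : All (All (_< M)) (B ∷ Bs)
  blocks<M = All-concat⁻ (All.map All.head below)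

-- The {12}-stack and the pattern 213

split-at-minimum : ∀ {w} → Unique w → w ≢ [] →
  ∃ λ L → ∃₂ λ m R → w ≡ L ++ m ∷ R × All (m <_) L × All (m <_) R
split-at-minimum {[]}        _           w≢[] = ⊥-elim (w≢[] refl)
split-at-minimum {x ∷ []}    _           _    = [] , x , [] , refl , [] , []
split-at-minimum {x ∷ y ∷ w} (x∉ ∷ uniq) _ with split-at-minimum uniq (λ ())
... | L , m , R , eq , m<L , m<R with <-cmp x m
...   | tri< x<m _ _ = [] , x , y ∷ w , refl , [] ,
        subst (All (x <_)) (sym eq) (All-++⁺ (All.map (<-trans x<m) m<L) (x<m ∷ All.map (<-trans x<m) m<R))
...   | tri≈ _ x≡m _ = ⊥-elim (All.lookup x∉ (subst (m ∈_) (sym eq) (∈-++⁺ʳ L (here refl))) x≡m)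
...   | tri> _ _ m<x = x ∷ L , m , R , cong (x ∷_) eq , m<x ∷ m<L , m<R

out-P₁₂-minimum : ∀ L {m} R → All (m <_) L → All (m <_) R →
  out P₁₂ (L ++ m ∷ R) ≡ out P₁₂ L ++ out P₁₂ R ++ m ∷ []
out-P₁₂-minimum L {m} R m<L m<R = begin
  runStack P₁₂ (L ++ m ∷ R) []       ≡⟨ runStack-++ L (m ∷ R) [] ⟩
  o ++ runStack P₁₂ (m ∷ R) s        ≡⟨ cong (o ++_) m-pops-s ⟩
  o ++ s ++ runStack P₁₂ R (m ∷ [])  ≡⟨ cong (λ r → o ++ s ++ r) (MinimumFloor.runStack-floor R m<R) ⟩
  o ++ s ++ out P₁₂ R ++ m ∷ []      ≡⟨ ++-assoc o s _ ⟨
  (o ++ s) ++ out P₁₂ R ++ m ∷ []    ≡⟨ cong (_++ _) (runStack-feed L []) ⟨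
  out P₁₂ L ++ out P₁₂ R ++ m ∷ []   ∎
  where
  open ≡-Reasoning
  o = proj₁ (feed P₁₂ L [])
  s = proj₂ (feed P₁₂ L [])
  m<s : All (m <_) s
  m<s = All.tabulate (All.lookup (All-++⁺ m<L []) ∘ feed-stack∈ L [])
  m-pops-s : runStack P₁₂ (m ∷ R) s ≡ s ++ runStack P₁₂ R (m ∷ [])
  m-pops-s = trans (cong (runStack P₁₂ (m ∷ R)) (sym (++-identityʳ s))) (runStack-pops-all R s tt
    (All.map (λ {y} m<y t ok → to (avoidsAll-P₁₂⇔ {m ∷ y ∷ t ++ []}) ok
                                 (m , y , m<y , refl ∷ refl ∷ minimum _)) m<s))

out-P₁₂-213-free : ∀ {w} → Unique w → Avoids231 (out P₁₂ w) → ¬ Occurs w pat213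
out-P₁₂-213-free {w} uniq av occ =
  let b , a , c , a<b , b<c , sub = Occurs-213⁻ occ in no-213 w (<-wellFounded (length w)) uniq av a<b b<c sub
  where
  no-213 : ∀ w → Acc _<_ (length w) → Unique w → Avoids231 (out P₁₂ w) →
    ∀ {a b c} → a < b → b < c → (b ∷ a ∷ c ∷ []) ⊆ w → ⊥
  no-213 w (acc rec) uniq av {a} {b} {c} a<b b<c sub with split-at-minimum uniq (∷⊆⇒≢[] sub)
  ... | L , m , R , refl , m<L , m<R = at-minimum (triple-⊆-++⁻ L sub)
    where
    av′ : Avoids231 (out P₁₂ L ++ out P₁₂ R ++ m ∷ [])
    av′ = subst Avoids231 (out-P₁₂-minimum L R m<L m<R) av
    uniqL : Unique L
    uniqL = proj₁ (AllPairs-++⁻ L uniq)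
    uniqR : Unique R
    uniqR = AllPairs.tail (proj₁ (proj₂ (AllPairs-++⁻ L uniq)))
    shorterL : length L < length (L ++ m ∷ R)
    shorterL = subst (length L <_) (sym (length-++ L)) (m<m+n (length L) z<s)
    shorterR : length R < length (L ++ m ∷ R)
    shorterR = subst (length R <_) (sym (length-++ L)) (m≤n+m (suc (length R)) (length L))
    across : b ∈ L → c ∈ R → ⊥
    across b∈L c∈R = <-asym (All.lookup m<L b∈L)
      (Avoids231-across (out P₁₂ L) av′ (∈-runStack L [] b∈L) (∈-runStack R [] c∈R) (here refl) b<c)
    at-minimum : (b ∷ a ∷ c ∷ []) ⊆ L ⊎ ((b ∷ a ∷ []) ⊆ L × c ∈ m ∷ R) ⊎
                 (b ∈ L × (a ∷ c ∷ []) ⊆ m ∷ R) ⊎ (b ∷ a ∷ c ∷ []) ⊆ m ∷ R → ⊥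
    at-minimum (inj₁ sub₁) =
      no-213 L (rec shorterL) uniqL (Avoids231-++ˡ (out P₁₂ L) av′) a<b b<c sub₁
    at-minimum (inj₂ (inj₁ (sub₁ , here refl))) =
      <-asym (<-trans a<b b<c) (All.lookup m<L (to∈ (∷ˡ⁻ sub₁)))
    at-minimum (inj₂ (inj₁ (sub₁ , there c∈R)))   = across (to∈ sub₁) c∈R
    at-minimum (inj₂ (inj₂ (inj₁ (b∈L , sub₂))))  = across b∈L (to∈ (∷⁻ sub₂))
    at-minimum (inj₂ (inj₂ (inj₂ (refl ∷ sub₂)))) = <-asym a<b (All.lookup m<R (to∈ sub₂))
    at-minimum (inj₂ (inj₂ (inj₂ (_ ∷ʳ sub₂)))) =
      no-213 R (rec shorterR) uniqR (Avoids231-++ˡ (out P₁₂ R) (Avoids231-++ʳ (out P₁₂ L) av′))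
        a<b b<c sub₂

blocks-avoid-213 : ∀ Bs {Y} → Unique (concat Bs) → Avoids231 (concat (map (out P₁₂) Bs) ++ Y) →
  All (λ B → avoids B pat213 ≡ true) Bs
blocks-avoid-213 []       _    _  = []
blocks-avoid-213 (B ∷ Bs) {Y} uniq av =
  to T-≡ (from avoids⇔¬Occurs (out-P₁₂-213-free uniqB (Avoids231-++ˡ (out P₁₂ B) av′))) ∷
  blocks-avoid-213 Bs uniqBs (Avoids231-++ʳ (out P₁₂ B) av′)
  where
  uniqB : Unique B
  uniqB = proj₁ (AllPairs-++⁻ B uniq)
  uniqBs : Unique (concat Bs)
  uniqBs = proj₁ (proj₂ (AllPairs-++⁻ B uniq))
  av′ : Avoids231 (out P₁₂ B ++ concat (map (out P₁₂) Bs) ++ Y)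
  av′ = subst Avoids231 (++-assoc (out P₁₂ B) _ Y) av

blocks-outputs : ∀ {Bts Bs Y} → Pointwise _↭_ Bts Bs →
  concat Bts ++ Y ≡ concat (map (out P₁₂) Bs) ++ Y →
  Pointwise (λ Bt B → Bt ≡ out P₁₂ B) Bts Bs
blocks-outputs []                   _  = []
blocks-outputs {Bt ∷ _} {B ∷ _} {Y} (Bt↭B ∷ Bts↭Bs) eq
  with ++-cancel-length Bt (out P₁₂ B) same-length
         (trans (sym (++-assoc Bt _ Y)) (trans eq (++-assoc (out P₁₂ B) _ Y)))
  where
  same-length : length Bt ≡ length (out P₁₂ B)
  same-length =
    trans (↭-length Bt↭B) (sym (trans (↭-length (runStack-↭ B [])) (cong length (++-identityʳ B))))
... | Bt≡ , rest≡ = Bt≡ ∷ blocks-outputs Bts↭Bs rest≡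

ltrMaxFrom-increasing : ∀ m w → All (m <_) (ltrMaxFrom m w) × AllPairs _<_ (ltrMaxFrom m w)
ltrMaxFrom-increasing m []      = [] , []
ltrMaxFrom-increasing m (x ∷ w) with m <ᵇ x | <ᵇ-reflects-< m x
... | true  | ofʸ m<x = let x<Ms , Ms↑ = ltrMaxFrom-increasing x w in
                       m<x ∷ All.map (<-trans m<x) x<Ms , x<Ms ∷ Ms↑
... | false | _       = ltrMaxFrom-increasing m w

ltrMaxFrom-dominates : ∀ {y} m w → m < y → y ∈ w → Any (y ≤_) (ltrMaxFrom m w)
ltrMaxFrom-dominates {y} m (x ∷ w) m<y y∈ with m <ᵇ x | <ᵇ-reflects-< m x | y∈
... | true  | ofʸ _   | here refl = here ≤-refl
... | true  | ofʸ _   | there y∈w with y ≤? x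
...   | yes y≤x = here y≤x
...   | no  y≰x = there (ltrMaxFrom-dominates x w (≰⇒> y≰x) y∈w)
ltrMaxFrom-dominates m (x ∷ w) m<y _ | false | ofⁿ m≮x | here refl = ⊥-elim (m≮x m<y)
ltrMaxFrom-dominates m (x ∷ w) m<y _ | false | ofⁿ _   | there y∈w = ltrMaxFrom-dominates m w m<y y∈w

assemble-↭ : ∀ Ms Bs → length Bs ≡ length Ms → assemble Ms Bs ↭ Ms ++ concat Bs
assemble-↭ []       []       _   = ↭-refl
assemble-↭ (M ∷ Ms) (B ∷ Bs) len = ↭-prep M (begin
  B ++ assemble Ms Bs   ↭⟨ ++⁺ˡ B (assemble-↭ Ms Bs (suc-injective len)) ⟩
  B ++ Ms ++ concat Bs  ↭⟨ shifts B Ms ⟩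
  Ms ++ B ++ concat Bs  ∎)
  where open PermutationReasoning

idPerm-increasing : ∀ n → AllPairs _<_ (idPerm n)
idPerm-increasing n = AllPairs-map⁺ (applyUpTo⁺₁ id n (λ i<j _ → s<s i<j))

entries-below-some-maximum : ∀ {n π Ms Bs} → π ↭ idPerm n → π ↭ Ms ++ concat Bs →
  Unique (Ms ++ concat Bs) → Ms ≡ ltrMaxima π → All (λ x → Any (x <_) Ms) (concat Bs)
entries-below-some-maximum {π = π} {Ms} π↭id π↭ uniq refl = All.tabulate λ {x} x∈Bs →
  let x∈π = ∈-resp-↭ (↭-sym π↭) (∈-++⁺ʳ Ms x∈Bs)
      M , M∈ , x≤M = find (ltrMaxFrom-dominates 0 π (positive (∈-resp-↭ π↭id x∈π)) x∈π)
      M≢x = All.lookup (All.lookup (proj₂ (proj₂ (AllPairs-++⁻ Ms uniq))) M∈) x∈Bs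
  in lose M∈ (≤∧≢⇒< x≤M (M≢x ∘ sym))
  where
  positive : ∀ {n x} → x ∈ idPerm n → 0 < x
  positive x∈ with ∈-map⁻ suc x∈
  ... | _ , _ , refl = z<s

below-all-maxima : ∀ {X Ms} → AllPairs _<_ Ms → Avoids231 (X ++ reverse Ms) →
  All (λ x → Any (x <_) Ms) X → All (λ x → All (x <_) Ms) X
below-all-maxima {X} {[]}     _          _  = All.map (λ _ → [])
below-all-maxima {X} {M ∷ Ms} (M<Ms ∷ _) av below-some = All.tabulate λ x∈X →
  let x<M = below-first x∈X (All.lookup below-some x∈X) in x<M ∷ All.map (<-trans x<M) M<Ms
  where
  below-first : ∀ {x} → x ∈ X → Any (x <_) (M ∷ Ms) → x < M
  below-first _   (here x<M)      = x<M
  below-first x∈X (there x<later) with find (Any-reverse⁺ x<later)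
  ... | M′ , M′∈ , x<M′ =
    Avoids231-across X (subst (λ r → Avoids231 (X ++ r)) (unfold-reverse M Ms) av) x∈X M′∈ (here refl) x<M′

mainTheorem10 : (n : ℕ) (π : List ℕ) → π ↭ idPerm n
    → Sortable (pat123 ∷ pat312 ∷ []) n π
    → (Ms : List ℕ) (Bs Bts : List (List ℕ))
    → Ms ≡ ltrMaxima π
    → length Bs ≡ length Ms
    → π ≡ assemble Ms Bs
    → Pointwise _↭_ Bts Bs
    → out (pat123 ∷ pat312 ∷ []) π ≡ concat Bts ++ reverse Ms
    → All (λ B → avoids B pat213 ≡ true) Bs
    × Pointwise (λ Bt B → Bt ≡ out (pat12 ∷ []) B) Bts Bs
mainTheorem10 n π π↭id sortable Ms Bs Bts Ms≡ len π≡ Bts↭Bs out≡ =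
  blocks-avoid-213 Bs (proj₁ (proj₂ (AllPairs-++⁻ Ms uniq))) (subst Avoids231 simulation avoid) ,
  blocks-outputs Bts↭Bs (trans (sym out≡) simulation)
  where
  π↭ : π ↭ Ms ++ concat Bs
  π↭ = subst (_↭ Ms ++ concat Bs) (sym π≡) (assemble-↭ Ms Bs len)
  uniq : Unique (Ms ++ concat Bs)
  uniq = Unique-resp-↭ (setoid ℕ) (↭⇒↭ₛ (↭-trans (↭-sym π↭id) π↭))
           (AllPairs.map <⇒≢ (idPerm-increasing n))
  Ms↑ : AllPairs _<_ Ms
  Ms↑ = subst (AllPairs _<_) (sym Ms≡) (proj₂ (ltrMaxFrom-increasing 0 π))
  avoid : Avoids231 (out P₁₂₃₋₃₁₂ π)
  avoid = stack-sorted⇒Avoids231 (subst (AllPairs _<_) (sym sortable) (idPerm-increasing n))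
  Bts↭ : concat Bts ↭ concat Bs
  Bts↭ = concat-↭ Bts↭Bs
  below : All (λ x → All (x <_) Ms) (concat Bs)
  below = All-resp-↭ Bts↭ (below-all-maxima Ms↑ (subst Avoids231 out≡ avoid)
            (All-resp-↭ (↭-sym Bts↭) (entries-below-some-maximum {Bs = Bs} π↭id π↭ uniq Ms≡)))
  simulation : out P₁₂₃₋₃₁₂ π ≡ concat (map (out P₁₂) Bs) ++ reverse Ms
  simulation = trans (cong (out P₁₂₃₋₃₁₂) π≡) (out-assemble Ms Bs len Ms↑ below)
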